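{- Let $n\ge 2$, let $T_1,\dots,T_n$ be positive integers with $T_i/T_{i+1}$ an integer for all $i<n$, let $C_1,\dots,C_{n-1}\ge 0$ and $J_1,\dots,J_n$ be numbers, let $c_i=\sum_{t=i+1}^{n-1}C_t$ for $i=1,\dots,n$ (empty sums are $0$), and assume $\sum_{t=1}^{n-1} C_t/T_t < 1$. Consider the system in integer variables $x_1,\dots,x_n$: \[J_i + T_ix_i \leq J_n + T_nx_n \leq J_i+T_ix_i + c_i \qquad \forall i\leq n-1.\] If $i < j \leq n$ and $(c_i+c_j)/T_j < 1$, then for every integer $z$ there is at most one integer $y$ such that the system has an integer solution $(x_1,\dots,x_n)$ with $x_i=z$ and $x_j=y$.
   Context: This system arises from worst-case response time analysis of harmonic tasks with release jitter on a uniprocessor: $T_i$ are periods, $C_i$ processing times, $J_i$ release jitters.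
   Formalization: The processing times $C_1,\dots,C_{n-1}$ and the release jitters $J_1,\dots,J_n$ take values in ℚ. -}

module Defs where

open import Data.Nat as ℕ using (ℕ; zero; suc; _∸_)
open import Data.Integer as ℤ using (ℤ; +_)
open import Data.Rational using (ℚ; _/_; _+_; _*_; 0ℚ)

ℤtoℚ : ℤ → ℚ
ℤtoℚ z = z / 1

ℕtoℚ : ℕ → ℚ
ℕtoℚ k = (+ k) / 1

-- q / T for a natural number T; only used with T > 0 (positivity is a
-- hypothesis of the theorem); the value at T = 0 is an irrelevant junk value 0.
divℕ : ℚ → ℕ → ℚ
divℕ q zero    = 0ℚ
divℕ q (suc k) = q * ((+ 1) / suc k)

sumFrom : (ℕ → ℚ) → ℕ → ℕ → ℚ
sumFrom f a zero    = 0ℚ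
sumFrom f a (suc k) = f a + sumFrom f (suc a) k

-- c_i = Σ_{t=i+1}^{n-1} C_t  (empty sum = 0; in particular c_{n-1} = c_n = 0)
cc : ℕ → (ℕ → ℚ) → ℕ → ℚ
cc n C i = sumFrom C (suc i) ((n ∸ 1) ∸ i)

util : ℕ → (ℕ → ℕ) → (ℕ → ℚ) → ℚ
util n T C = sumFrom (λ t → divℕ (C t) (T t)) 1 (n ∸ 1)

IsSolution : ℕ → (ℕ → ℕ) → (ℕ → ℚ) → (ℕ → ℚ) → (ℕ → ℤ) → Set
IsSolution n T C J x =
  ∀ i → 1 ℕ.≤ i → i ℕ.≤ n ∸ 1 →
    (J i + ℕtoℚ (T i) * ℤtoℚ (x i) Data.Rational.≤ J n + ℕtoℚ (T n) * ℤtoℚ (x n))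
    Data.Product.× (J n + ℕtoℚ (T n) * ℤtoℚ (x n) Data.Rational.≤ (J i + ℕtoℚ (T i) * ℤtoℚ (x i)) + cc n C i)
  where import Data.Product

{-# OPTIONS --safe #-}
-- Write r_k(x) = J_k + T_k x_k. If x and x′ solve the system and x_i = x′_i, then
--   r_j(x) ≤ r_n(x) ≤ r_i(x) + c_i = r_i(x′) + c_i ≤ r_n(x′) + c_i ≤ r_j(x′) + c_j + c_i,
-- so T_j (x_j − x′_j) ≤ c_i + c_j < T_j and hence x_j ≤ x′_j; by symmetry x_j = x′_j.
-- The case j = n is covered because c_n = 0.
module Submission where

open import Defs
open import Data.Nat as ℕ using (ℕ; _≥_; _<_; _≤_; _∸_; suc)
open import Data.Nat.Divisibility using (_∣_)
open import Data.Integer as ℤ using (ℤ; +_)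
open import Data.Rational as ℚ using (ℚ; 0ℚ; 1ℚ; _+_; _*_; -_; toℚᵘ; Positive)
open import Data.Product using (_×_; ∃; _,_; proj₁; proj₂)
open import Data.Sum using (inj₁; inj₂)
open import Relation.Binary.PropositionalEquality
  using (_≡_; refl; sym; trans; cong; cong₂; subst; subst₂; module ≡-Reasoning)

import Data.Nat.Properties as ℕ
import Data.Integer.Properties as ℤ
open import Data.Rational.Properties
open import Data.Rational.Solver using (module +-*-Solver)
import Data.Rational.Unnormalised as ℚᵘ
import Data.Rational.Unnormalised.Properties as ℚᵘ

toℚᵘ-ℤtoℚ : ∀ a → toℚᵘ (ℤtoℚ a) ℚᵘ.≃ ℚᵘ.mkℚᵘ a 0
toℚᵘ-ℤtoℚ a = toℚᵘ-fromℚᵘ (ℚᵘ.mkℚᵘ a 0)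

ℤtoℚ-cancel-< : ∀ {a b} → ℤtoℚ a ℚ.< ℤtoℚ b → a ℤ.< b
ℤtoℚ-cancel-< {a} {b} a<b
  with ℚᵘ.<-respʳ-≃ (toℚᵘ-ℤtoℚ b) (ℚᵘ.<-respˡ-≃ (toℚᵘ-ℤtoℚ a) (toℚᵘ-mono-< a<b))
... | ℚᵘ.*<* a*1<b*1 = subst₂ ℤ._<_ (ℤ.*-identityʳ a) (ℤ.*-identityʳ b) a*1<b*1

ℤtoℚ-homo-+ : ∀ a b → ℤtoℚ (a ℤ.+ b) ≡ ℤtoℚ a + ℤtoℚ b
ℤtoℚ-homo-+ a b = toℚᵘ-injective (begin
  toℚᵘ (ℤtoℚ (a ℤ.+ b))            ≈⟨ toℚᵘ-ℤtoℚ (a ℤ.+ b) ⟩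
  ℚᵘ.mkℚᵘ (a ℤ.+ b) 0              ≈⟨ ℚᵘ.*≡* (cong (ℤ._* + 1) (sym a*1+b*1≡a+b)) ⟩
  ℚᵘ.mkℚᵘ a 0 ℚᵘ.+ ℚᵘ.mkℚᵘ b 0     ≈⟨ ℚᵘ.+-cong (toℚᵘ-ℤtoℚ a) (toℚᵘ-ℤtoℚ b) ⟨
  toℚᵘ (ℤtoℚ a) ℚᵘ.+ toℚᵘ (ℤtoℚ b) ≈⟨ toℚᵘ-homo-+ (ℤtoℚ a) (ℤtoℚ b) ⟨
  toℚᵘ (ℤtoℚ a + ℤtoℚ b)           ∎)
  where
  open import Relation.Binary.Reasoning.Setoid ℚᵘ.≃-setoid
  a*1+b*1≡a+b : a ℤ.* + 1 ℤ.+ b ℤ.* + 1 ≡ a ℤ.+ b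
  a*1+b*1≡a+b = cong₂ ℤ._+_ (ℤ.*-identityʳ a) (ℤ.*-identityʳ b)

ℤtoℚ<1+ℤtoℚ⇒≤ : ∀ {a b} → ℤtoℚ a ℚ.< 1ℚ + ℤtoℚ b → a ℤ.≤ b
ℤtoℚ<1+ℤtoℚ⇒≤ {a} {b} a<1+b = subst (a ℤ.≤_) (ℤ.pred-suc b)
  (ℤ.i<j⇒i≤pred[j] {j = ℤ.suc b}
    (ℤtoℚ-cancel-< (subst (ℤtoℚ a ℚ.<_) (sym (ℤtoℚ-homo-+ (+ 1) b)) a<1+b)))

ℕtoℚ-pos : ∀ {t} → 0 < t → Positive (ℕtoℚ t)
ℕtoℚ-pos {suc k} _ = normalize-pos (suc k) 1

ℕtoℚ-inverseˡ : ∀ k → (+ 1 ℚ./ suc k) * ℕtoℚ (suc k) ≡ 1ℚ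
ℕtoℚ-inverseˡ k = toℚᵘ-injective (begin
  toℚᵘ ((+ 1 ℚ./ suc k) * ℕtoℚ (suc k))
    ≈⟨ toℚᵘ-homo-* (+ 1 ℚ./ suc k) (ℕtoℚ (suc k)) ⟩
  toℚᵘ (+ 1 ℚ./ suc k) ℚᵘ.* toℚᵘ (ℕtoℚ (suc k))
    ≈⟨ ℚᵘ.*-cong (toℚᵘ-fromℚᵘ (ℚᵘ.mkℚᵘ (+ 1) k)) (toℚᵘ-ℤtoℚ (+ suc k)) ⟩
  ℚᵘ.1/ ℚᵘ.mkℚᵘ (+ suc k) 0 ℚᵘ.* ℚᵘ.mkℚᵘ (+ suc k) 0
    ≈⟨ ℚᵘ.*-inverseˡ (ℚᵘ.mkℚᵘ (+ suc k) 0) ⟩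
  ℚᵘ.1ℚᵘ
    ∎)
  where open import Relation.Binary.Reasoning.Setoid ℚᵘ.≃-setoid

divℕ<1⇒< : ∀ {q} t → 0 < t → divℕ q t ℚ.< 1ℚ → q ℚ.< ℕtoℚ t
divℕ<1⇒< {q} (suc k) 0<t q/t<1 =
  subst₂ ℚ._<_ q/t*t≡q (*-identityˡ t) (*-monoˡ-<-pos t {{ℕtoℚ-pos 0<t}} q/t<1)
  where
  t = ℕtoℚ (suc k)
  q/t*t≡q : divℕ q (suc k) * t ≡ q
  q/t*t≡q = begin
    q * (+ 1 ℚ./ suc k) * t    ≡⟨ *-assoc q _ t ⟩
    q * ((+ 1 ℚ./ suc k) * t)  ≡⟨ cong (q *_) (ℕtoℚ-inverseˡ k) ⟩
    q * 1ℚ                     ≡⟨ *-identityʳ q ⟩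
    q                          ∎
    where open ≡-Reasoning

+-cancelˡ-≤ : ∀ r {p q} → r + p ℚ.≤ r + q → p ℚ.≤ q
+-cancelˡ-≤ r {p} {q} r+p≤r+q =
  subst₂ ℚ._≤_ (-r+[r+s]≡s p) (-r+[r+s]≡s q) (+-monoʳ-≤ (- r) r+p≤r+q)
  where
  open +-*-Solver
  -r+[r+s]≡s : ∀ s → - r + (r + s) ≡ s
  -r+[r+s]≡s = solve 2 (λ r s → :- r :+ (r :+ s) := s) refl r

t*a≤t*b+s⇒a≤b : ∀ t .{{_ : Positive t}} {s a b} → s ℚ.< t →
                t * ℤtoℚ a ℚ.≤ t * ℤtoℚ b + s → a ℤ.≤ b
t*a≤t*b+s⇒a≤b t {s} {a} {b} s<t ta≤tb+s =
  ℤtoℚ<1+ℤtoℚ⇒≤ (*-cancelˡ-<-nonNeg t {{pos⇒nonNeg t}} (begin-strict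
    t * ℤtoℚ a        ≤⟨ ta≤tb+s ⟩
    t * ℤtoℚ b + s    <⟨ +-monoʳ-< (t * ℤtoℚ b) s<t ⟩
    t * ℤtoℚ b + t    ≡⟨ solve 2 (λ t b → t :* b :+ t := t :* (con 1ℚ :+ b)) refl t (ℤtoℚ b) ⟩
    t * (1ℚ + ℤtoℚ b) ∎))
  where
  open ≤-Reasoning
  open +-*-Solver

cc≡0 : ∀ n C {k} → n ∸ 1 ≤ k → cc n C k ≡ 0ℚ
cc≡0 n C {k} n∸1≤k = cong (sumFrom C (suc k)) (ℕ.m≤n⇒m∸n≡0 n∸1≤k)

module Solutions (n : ℕ) (T : ℕ → ℕ) (C J : ℕ → ℚ) where

  release : (ℕ → ℤ) → ℕ → ℚ
  release x k = J k + ℕtoℚ (T k) * ℤtoℚ (x k)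

  solution-bounds : ∀ x {k} → IsSolution n T C J x → 1 ≤ k → k ≤ n →
                    release x k ℚ.≤ release x n × release x n ℚ.≤ release x k + cc n C k
  solution-bounds x {k} sol 1≤k k≤n with ℕ.m≤n⇒m<n∨m≡n k≤n
  ... | inj₁ k<n  = sol k 1≤k (subst (k ≤_) (ℕ.pred[m∸n]≡m∸[1+n] n 0) (ℕ.<⇒≤pred k<n))
  ... | inj₂ refl = ≤-refl , ≤-reflexive (sym (begin
    release x n + cc n C n ≡⟨ cong (_+_ (release x n)) (cc≡0 n C (ℕ.m∸n≤m n 1)) ⟩
    release x n + 0ℚ       ≡⟨ +-identityʳ (release x n) ⟩
    release x n            ∎))
    where open ≡-Reasoning

  last-release-shift : ∀ x x′ {i} → IsSolution n T C J x → IsSolution n T C J x′ →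
                       x i ≡ x′ i → 1 ≤ i → i ≤ n →
                       release x n ℚ.≤ release x′ n + cc n C i
  last-release-shift x x′ {i} sol sol′ xi≡x′i 1≤i i≤n = begin
    release x n             ≤⟨ proj₂ (solution-bounds x sol 1≤i i≤n) ⟩
    release x i + cc n C i  ≡⟨ cong (λ v → J i + ℕtoℚ (T i) * ℤtoℚ v + cc n C i) xi≡x′i ⟩
    release x′ i + cc n C i ≤⟨ +-monoˡ-≤ (cc n C i) (proj₁ (solution-bounds x′ sol′ 1≤i i≤n)) ⟩
    release x′ n + cc n C i ∎
    where open ≤-Reasoning

  agreeing-solutions-≤ : ∀ x x′ {i j} → IsSolution n T C J x → IsSolution n T C J x′ →
                         x i ≡ x′ i → 1 ≤ i → i ≤ n → 1 ≤ j → j ≤ n → 0 < T j →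
                         divℕ (cc n C i + cc n C j) (T j) ℚ.< 1ℚ → x j ℤ.≤ x′ j
  agreeing-solutions-≤ x x′ {i} {j} sol sol′ xi≡x′i 1≤i i≤n 1≤j j≤n 0<Tj slack =
    t*a≤t*b+s⇒a≤b (ℕtoℚ (T j)) {{ℕtoℚ-pos 0<Tj}} (divℕ<1⇒< (T j) 0<Tj slack)
      (+-cancelˡ-≤ (J j) (begin
        release x j               ≤⟨ proj₁ (solution-bounds x sol 1≤j j≤n) ⟩
        release x n               ≤⟨ last-release-shift x x′ sol sol′ xi≡x′i 1≤i i≤n ⟩
        release x′ n + ci         ≤⟨ +-monoˡ-≤ ci (proj₂ (solution-bounds x′ sol′ 1≤j j≤n)) ⟩
        release x′ j + cj + ci    ≡⟨ solve 4 (λ J a ci cj → J :+ a :+ cj :+ ci := J :+ (a :+ (ci :+ cj)))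
                                           refl (J j) Tx′ ci cj ⟩
        J j + (Tx′ + (ci + cj))   ∎))
    where
    open ≤-Reasoning
    open +-*-Solver
    ci = cc n C i
    cj = cc n C j
    Tx′ = ℕtoℚ (T j) * ℤtoℚ (x′ j)

lemma14 : (n : ℕ) → n ≥ 2 →
    (T : ℕ → ℕ) (C J : ℕ → ℚ) →
    (∀ i → 1 ≤ i → i ≤ n → 0 < T i) →
    (∀ i → 1 ≤ i → i < n → T (suc i) ∣ T i) →
    (∀ t → 1 ≤ t → t ≤ n ∸ 1 → 0ℚ ℚ.≤ C t) →
    util n T C ℚ.< 1ℚ →
    (i j : ℕ) → 1 ≤ i → i < j → j ≤ n →
    divℕ (cc n C i + cc n C j) (T j) ℚ.< 1ℚ →
    (z y y′ : ℤ) →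
    (∃ λ x → IsSolution n T C J x × x i ≡ z × x j ≡ y) →
    (∃ λ x → IsSolution n T C J x × x i ≡ z × x j ≡ y′) →
    y ≡ y′
lemma14 n _ T C J T-pos _ _ _ i j 1≤i i<j j≤n slack z y y′
        (x , sol , xi≡z , xj≡y) (x′ , sol′ , x′i≡z , x′j≡y′) =
  ℤ.≤-antisym (subst₂ ℤ._≤_ xj≡y x′j≡y′ (≤-at-j x x′ sol sol′ (trans xi≡z (sym x′i≡z))))
              (subst₂ ℤ._≤_ x′j≡y′ xj≡y (≤-at-j x′ x sol′ sol (trans x′i≡z (sym xi≡z))))
  where
  open Solutions n T C J
  1≤j = ℕ.≤-trans 1≤i (ℕ.<⇒≤ i<j)
  i≤n = ℕ.<⇒≤ (ℕ.<-≤-trans i<j j≤n)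
  ≤-at-j : ∀ x x′ → IsSolution n T C J x → IsSolution n T C J x′ → x i ≡ x′ i → x j ℤ.≤ x′ j
  ≤-at-j x x′ sol sol′ xi≡x′i =
    agreeing-solutions-≤ x x′ sol sol′ xi≡x′i 1≤i i≤n 1≤j j≤n (T-pos j 1≤j j≤n) slack
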